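{- Let $n \in \mathbb{N}$, $t \in \{0,1,\dots,n-1\}$, and let $A \subset S_n$ be an initial segment of the lexicographic order on $S_n$ with $(n-t-1)! < |A| \le (n-t)!$. Then \[ |\partial A| \le (t + 3/2)(n-1)|A|. \]
   Context: $S_n$ is the symmetric group on $[n]$. The lexicographic order on $S_n$: $\sigma<\pi$ iff $\sigma(j)<\pi(j)$ where $j=\min\{i\in[n]:\sigma(i)\ne\pi(i)\}$. An initial segment of size $k$ is the set of the $k$ smallest elements in this order. $\partial A$ is the edge-boundary of $A$ in the transposition graph $T_n$ (the Cayley graph on $S_n$ generated by all transpositions: $\sigma,\pi$ adjacent iff $\sigma\pi^{ -1}$ is a transposition), i.e. the set of edges of $T_n$ with exactly one endpoint in $A$. -}

module Defs where

open import Data.Bool using (Bool; true; false; if_then_else_)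
open import Data.Nat as ℕ using (ℕ; zero; suc)
open import Data.Fin as Fin using (Fin)
open import Data.Fin.Properties using (any?; all?; _≟_)
open import Data.Vec using (Vec; []; _∷_; lookup)
open import Data.List using (List; []; _∷_; [_]; map; concatMap; filter; length; cartesianProduct)
open import Data.List using (allFin)
open import Data.Product using (_×_; _,_; ∃-syntax; proj₁; proj₂)
open import Relation.Nullary using (Dec; ¬_; ¬?; _×-dec_; _→-dec_; does)
open import Relation.Binary.PropositionalEquality using (_≡_)

Word : ℕ → Set
Word n = Vec (Fin n) n

allVecs : (k m : ℕ) → List (Vec (Fin m) k)
allVecs zero    m = [ [] ]
allVecs (suc k) m = concatMap (λ x → map (x ∷_) (allVecs k m)) (allFin m)

-- σ is a permutation of [n] (injective map Fin n → Fin n, hence bijective)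
IsPerm : ∀ {n} → Word n → Set
IsPerm σ = ∀ i j → lookup σ i ≡ lookup σ j → i ≡ j

isPerm? : ∀ {n} (σ : Word n) → Dec (IsPerm σ)
isPerm? σ = all? (λ i → all? (λ j → (lookup σ i ≟ lookup σ j) →-dec (i ≟ j)))

Sym : (n : ℕ) → List (Word n)
Sym n = filter isPerm? (allVecs n n)

_<lex_ : ∀ {n} → Word n → Word n → Set
σ <lex π = ∃[ j ] ((∀ i → i Fin.< j → lookup σ i ≡ lookup π i) × lookup σ j Fin.< lookup π j)

swapF : ∀ {n} → Fin n → Fin n → Fin n → Fin n
swapF a b x = if does (x ≟ a) then b else (if does (x ≟ b) then a else x)

-- σ π⁻¹ is a transposition (a b), i.e. σ = (a b) ∘ π with a ≠ b:
-- adjacency in the transposition graph T_n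
Adj : ∀ {n} → Word n → Word n → Set
Adj σ π = ∃[ a ] ∃[ b ] (¬ (a ≡ b) × (∀ x → lookup σ x ≡ swapF a b (lookup π x)))

adj? : ∀ {n} (σ π : Word n) → Dec (Adj σ π)
adj? σ π = any? (λ a → any? (λ b → ¬? (a ≟ b) ×-dec all? (λ x → lookup σ x ≟ swapF a b (lookup π x))))

-- A subset of S_n given by a characteristic function (only its values on Sym n matter)
Subset : ℕ → Set
Subset n = Word n → Bool

card : ∀ {n} → Subset n → ℕ
card {n} A = length (filter (λ σ → A σ Data.Bool.≟ true) (Sym n))
  where import Data.Bool

IsInitialSegment : ∀ {n} → Subset n → Set
IsInitialSegment {n} A =
  ∀ σ π → IsPerm σ → IsPerm π → A σ ≡ true → π <lex σ → A π ≡ true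

crossPairs : ∀ {n} → Subset n → List (Word n × Word n)
crossPairs {n} A = filter (λ p → (A (proj₁ p) ≟B true) ×-dec (A (proj₂ p) ≟B false))
                          (cartesianProduct (Sym n) (Sym n))
  where open import Data.Bool using () renaming (_≟_ to _≟B_)

-- |∂A|: edges of T_n with exactly one endpoint in A
-- (each such edge is counted once, oriented from A to its complement)
boundarySize : ∀ {n} → Subset n → ℕ
boundarySize A = length (filter (λ p → adj? (proj₁ p) (proj₂ p)) (crossPairs A))

module Submission where

-- Let μ be the lexicographically largest permutation in A.  If σ ∈ A and π ∉ A differ by a
-- transposition and i is the first position where they differ, then σ agrees with μ before i
-- (otherwise σ > μ, or π < μ and then π ∈ A), and π is σ with the values σ(i) and π(i)
-- exchanged, where π(i) does not occur among σ(0), …, σ(i).  So σ has at most n − 1 − i such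
-- neighbours, and |∂A| ≤ Σⱼ Nⱼ (n − 1 − j) with Nⱼ = #{σ ∈ A : σ agrees with μ before j}.
-- Here Nⱼ ≤ min(|A|, (n − j)!).  Since |A| > (n − t − 1)!, some σ ∈ A leaves μ's prefix
-- before position t + 1, and the whole block of permutations sharing σ's prefix up to that
-- point lies below μ; hence N_{t+1} + (n − t − 1)! ≤ |A|.  Bounding the terms j ≤ t by
-- |A|(n − 1) and the others using Σ_{s=1}^{M} s!(s − 1) < (M + 1)! gives the claim.

open import Defs
open import Data.Nat using (ℕ; _+_; _*_; _∸_; _<_; _≤_; _!; zero; suc; z≤n; s≤s)
import Data.Nat as ℕ
import Data.Nat.Properties as ℕₚ
open import Data.Fin as Fin using (Fin; toℕ; fromℕ<)
import Data.Fin.Properties as Finₚ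
open import Data.Vec as Vec using (Vec; []; _∷_; lookup)
import Data.Vec.Properties as Vecₚ
open import Data.Vec.Relation.Unary.All as All using (All; []; _∷_; all?)
open import Data.Vec.Relation.Unary.AllPairs using (allPairs?; _∷_)
open import Data.Vec.Relation.Unary.Unique.Propositional using (Unique)
import Data.Vec.Relation.Unary.Unique.Propositional.Properties as Uniqueₚ
open import Data.List as List using (List; []; _∷_; filter; length; concatMap; cartesianProduct; allFin; tabulate; _++_)
open import Data.List.Membership.Propositional using (_∈_)
import Data.List.Properties as Listₚ
import Data.List.Membership.Propositional.Properties as ∈ₚ
open import Data.List.Relation.Unary.Any using (here; there)
open import Data.Product using (_×_; _,_; proj₁; proj₂; ∃-syntax; Σ-syntax)
open import Data.Sum using (_⊎_; inj₁; inj₂; [_,_]′)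
open import Data.Empty using (⊥; ⊥-elim)
open import Data.Bool using (true; false) renaming (_≟_ to _≟ᵇ_)
open import Relation.Nullary using (Dec; yes; no; ¬_; _×-dec_; _⊎-dec_; _→-dec_; ¬?)
open import Relation.Unary using (Pred; Decidable)
open import Relation.Binary.PropositionalEquality
open import Relation.Binary.Definitions using (tri<; tri≈; tri>)
open import Level using (Level)
open import Function using (_∘_)
open import Data.Nat.Tactic.RingSolver using (solve-∀)
open import Data.Nat.Divisibility using (∣⇒≤; m≤n⇒m!∣n!)

private variable
  a ℓ ℓ′ : Level
  A B : Set a

-- Indicators and finite sums

𝟙 : {P : Set ℓ} → Dec P → ℕ
𝟙 (yes _) = 1
𝟙 (no _)  = 0

∑ : (A → ℕ) → List A → ℕ
∑ f []       = 0
∑ f (x ∷ xs) = f x + ∑ f xs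

syntax ∑ (λ x → e) xs = ∑[ x ∈ xs ] e

module _ {P : Set ℓ} where

  𝟙-yes : (d : Dec P) → P → 𝟙 d ≡ 1
  𝟙-yes (yes _) _ = refl
  𝟙-yes (no ¬p) p = ⊥-elim (¬p p)

  𝟙-no : (d : Dec P) → ¬ P → 𝟙 d ≡ 0
  𝟙-no (yes p) ¬p = ⊥-elim (¬p p)
  𝟙-no (no _)  _  = refl

  𝟙-pos : (d : Dec P) → 0 < 𝟙 d → P
  𝟙-pos (yes p) _ = p

  𝟙-¬ : (d : Dec P) → 𝟙 d + 𝟙 (¬? d) ≡ 1
  𝟙-¬ (yes _) = refl
  𝟙-¬ (no _)  = refl

  𝟙-≤ : (d : Dec P) {x : ℕ} → (P → 1 ≤ x) → 𝟙 d ≤ x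
  𝟙-≤ (yes p) h = h p
  𝟙-≤ (no _)  h = z≤n

  𝟙*-≤ : (d : Dec P) {x y : ℕ} → (P → x ≤ y) → 𝟙 d * x ≤ y
  𝟙*-≤ (yes p) {x} h = ℕₚ.≤-trans (ℕₚ.≤-reflexive (ℕₚ.+-identityʳ x)) (h p)
  𝟙*-≤ (no _)      h = z≤n

𝟙-mono : {P : Set ℓ} {Q : Set ℓ′} → (P → Q) → (d : Dec P) (e : Dec Q) → 𝟙 d ≤ 𝟙 e
𝟙-mono f (yes p) (yes _) = s≤s z≤n
𝟙-mono f (yes p) (no ¬q) = ⊥-elim (¬q (f p))
𝟙-mono f (no _)  e       = z≤n

module _ {P : Set ℓ} {Q : Set ℓ′} where

  𝟙-cong : (P → Q) → (Q → P) → (d : Dec P) (e : Dec Q) → 𝟙 d ≡ 𝟙 e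
  𝟙-cong f g d e = ℕₚ.≤-antisym (𝟙-mono f d e) (𝟙-mono g e d)

  𝟙-× : (d : Dec P) (e : Dec Q) → 𝟙 (d ×-dec e) ≡ 𝟙 d * 𝟙 e
  𝟙-× (yes _) (yes _) = refl
  𝟙-× (yes _) (no _)  = refl
  𝟙-× (no _)  _       = refl

  𝟙-disjoint-⊎ : {R : Set a} → (R → P ⊎ Q) → (P → R) → (Q → R) → (P → ¬ Q) →
                 (d : Dec P) (e : Dec Q) (r : Dec R) → 𝟙 r ≡ 𝟙 d + 𝟙 e
  𝟙-disjoint-⊎ split f g disj (yes p) (yes q) r = ⊥-elim (disj p q)
  𝟙-disjoint-⊎ split f g disj (yes p) (no _)  r = 𝟙-yes r (f p)
  𝟙-disjoint-⊎ split f g disj (no _)  (yes q) r = 𝟙-yes r (g q)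
  𝟙-disjoint-⊎ split f g disj (no ¬p) (no ¬q) r = 𝟙-no r (λ x → [ ¬p , ¬q ]′ (split x))

∑-ext : {f g : A → ℕ} → (∀ x → f x ≡ g x) → (xs : List A) → ∑ f xs ≡ ∑ g xs
∑-ext e []       = refl
∑-ext e (x ∷ xs) = cong₂ _+_ (e x) (∑-ext e xs)

∑-mono : {f g : A → ℕ} → (∀ x → f x ≤ g x) → (xs : List A) → ∑ f xs ≤ ∑ g xs
∑-mono h []       = z≤n
∑-mono h (x ∷ xs) = ℕₚ.+-mono-≤ (h x) (∑-mono h xs)

∑-zero : (xs : List A) → ∑[ x ∈ xs ] 0 ≡ 0
∑-zero []       = refl
∑-zero (x ∷ xs) = ∑-zero xs

∑-+ : (f g : A → ℕ) (xs : List A) → ∑[ x ∈ xs ] (f x + g x) ≡ ∑ f xs + ∑ g xs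
∑-+ f g []       = refl
∑-+ f g (x ∷ xs) = trans (cong (f x + g x +_) (∑-+ f g xs)) (interchange (f x) (g x) _ _)
  where
  interchange : ∀ a b c d → a + b + (c + d) ≡ (a + c) + (b + d)
  interchange = solve-∀

∑-*ˡ : (c : ℕ) (f : A → ℕ) (xs : List A) → ∑[ x ∈ xs ] (c * f x) ≡ c * ∑ f xs
∑-*ˡ c f []       = sym (ℕₚ.*-zeroʳ c)
∑-*ˡ c f (x ∷ xs) = trans (cong (c * f x +_) (∑-*ˡ c f xs)) (sym (ℕₚ.*-distribˡ-+ c (f x) _))

∑-*ʳ : (c : ℕ) (f : A → ℕ) (xs : List A) → ∑[ x ∈ xs ] (f x * c) ≡ ∑ f xs * c
∑-*ʳ c f xs = trans (∑-ext (λ x → ℕₚ.*-comm (f x) c) xs) (trans (∑-*ˡ c f xs) (ℕₚ.*-comm c _))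

∑-comm : (f : A → B → ℕ) (xs : List A) (ys : List B) →
         ∑[ x ∈ xs ] ∑[ y ∈ ys ] f x y ≡ ∑[ y ∈ ys ] ∑[ x ∈ xs ] f x y
∑-comm f []       ys = sym (∑-zero ys)
∑-comm f (x ∷ xs) ys = trans (cong (∑ (f x) ys +_) (∑-comm f xs ys)) (sym (∑-+ (f x) _ ys))

∑-++ : (f : A → ℕ) (xs ys : List A) → ∑ f (xs ++ ys) ≡ ∑ f xs + ∑ f ys
∑-++ f []       ys = refl
∑-++ f (x ∷ xs) ys = trans (cong (f x +_) (∑-++ f xs ys)) (sym (ℕₚ.+-assoc (f x) _ _))

∑-map : (f : B → ℕ) (g : A → B) (xs : List A) → ∑ f (List.map g xs) ≡ ∑[ x ∈ xs ] f (g x)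
∑-map f g []       = refl
∑-map f g (x ∷ xs) = cong (f (g x) +_) (∑-map f g xs)

∑-concatMap : (f : B → ℕ) (g : A → List B) (xs : List A) →
              ∑ f (concatMap g xs) ≡ ∑[ x ∈ xs ] ∑ f (g x)
∑-concatMap f g []       = refl
∑-concatMap f g (x ∷ xs) = trans (∑-++ f (g x) (concatMap g xs)) (cong (∑ f (g x) +_) (∑-concatMap f g xs))

∑-cartesianProduct : (f : A × B → ℕ) (xs : List A) (ys : List B) →
                     ∑ f (cartesianProduct xs ys) ≡ ∑[ x ∈ xs ] ∑[ y ∈ ys ] f (x , y)
∑-cartesianProduct f []       ys = refl
∑-cartesianProduct f (x ∷ xs) ys =
  trans (∑-++ f (List.map (x ,_) ys) _) (cong₂ _+_ (∑-map f (x ,_) ys) (∑-cartesianProduct f xs ys))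

∑-filter : {P : Pred A ℓ} (P? : Decidable P) (f : A → ℕ) (xs : List A) →
           ∑ f (filter P? xs) ≡ ∑[ x ∈ xs ] (𝟙 (P? x) * f x)
∑-filter P? f []       = refl
∑-filter P? f (x ∷ xs) with P? x
... | yes _ = cong₂ _+_ (sym (ℕₚ.+-identityʳ (f x))) (∑-filter P? f xs)
... | no _  = ∑-filter P? f xs

length-filter : {P : Pred A ℓ} (P? : Decidable P) (xs : List A) →
                length (filter P? xs) ≡ ∑[ x ∈ xs ] 𝟙 (P? x)
length-filter P? []       = refl
length-filter P? (x ∷ xs) with P? x
... | yes _ = cong suc (length-filter P? xs)
... | no _  = length-filter P? xs

∑-𝟙-¬ : {P : Pred A ℓ} (P? : Decidable P) (xs : List A) →
        ∑[ x ∈ xs ] 𝟙 (P? x) + ∑[ x ∈ xs ] 𝟙 (¬? (P? x)) ≡ length xs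
∑-𝟙-¬ P? xs = trans (sym (∑-+ _ _ xs)) (trans (∑-ext (λ x → 𝟙-¬ (P? x)) xs) (ones xs))
  where
  ones : (xs : List _) → ∑[ x ∈ xs ] 1 ≡ length xs
  ones []       = refl
  ones (x ∷ xs) = cong suc (ones xs)

∑-∈ : (f : A → ℕ) {x : A} {xs : List A} → x ∈ xs → f x ≤ ∑ f xs
∑-∈ f (here refl) = ℕₚ.m≤m+n _ _
∑-∈ f {xs = y ∷ ys} (there p) = ℕₚ.≤-trans (∑-∈ f p) (ℕₚ.m≤n+m _ (f y))

∑-pos : (f : A → ℕ) (xs : List A) → 0 < ∑ f xs → ∃[ x ] 0 < f x
∑-pos f (x ∷ xs) p with f x in eq
... | suc _ = x , subst (0 <_) (sym eq) (s≤s z≤n)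
... | zero  = ∑-pos f xs p

∑-tabulate : ∀ {m} (f : A → ℕ) (g : Fin m → A) → ∑ f (tabulate g) ≡ ∑[ i ∈ allFin m ] f (g i)
∑-tabulate {m = zero}  f g = refl
∑-tabulate {m = suc m} f g =
  cong (f (g Fin.zero) +_) (trans (∑-tabulate f (g ∘ Fin.suc)) (sym (∑-tabulate (f ∘ g) Fin.suc)))

∑< : ℕ → (ℕ → ℕ) → ℕ
∑< zero    f = 0
∑< (suc m) f = f 0 + ∑< m (λ j → f (suc j))

syntax ∑< m (λ j → e) = ∑[ j < m ] e

∑-allFin-toℕ : ∀ m (f : ℕ → ℕ) → ∑[ i ∈ allFin m ] f (toℕ i) ≡ ∑[ j < m ] f j
∑-allFin-toℕ zero    f = refl
∑-allFin-toℕ (suc m) f =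
  cong (f 0 +_) (trans (∑-tabulate {m = m} (λ i → f (toℕ i)) Fin.suc) (∑-allFin-toℕ m (λ j → f (suc j))))

∑<-+ : ∀ a b (f : ℕ → ℕ) → ∑[ j < a + b ] f j ≡ ∑[ j < a ] f j + ∑[ j < b ] f (a + j)
∑<-+ zero    b f = refl
∑<-+ (suc a) b f = trans (cong (f 0 +_) (∑<-+ a b (λ j → f (suc j)))) (sym (ℕₚ.+-assoc (f 0) _ _))

∑<-cong : ∀ m {f g : ℕ → ℕ} → (∀ j → f j ≡ g j) → ∑[ j < m ] f j ≡ ∑[ j < m ] g j
∑<-cong zero    h = refl
∑<-cong (suc m) h = cong₂ _+_ (h 0) (∑<-cong m (λ j → h (suc j)))

∑<-mono : ∀ m {f g : ℕ → ℕ} → (∀ j → j < m → f j ≤ g j) → ∑[ j < m ] f j ≤ ∑[ j < m ] g j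
∑<-mono zero    h = z≤n
∑<-mono (suc m) h = ℕₚ.+-mono-≤ (h 0 (s≤s z≤n)) (∑<-mono m (λ j j<m → h (suc j) (s≤s j<m)))

∑<-≤-* : ∀ m (f : ℕ → ℕ) c → (∀ j → f j ≤ c) → ∑[ j < m ] f j ≤ m * c
∑<-≤-* zero    f c h = z≤n
∑<-≤-* (suc m) f c h = ℕₚ.+-mono-≤ (h 0) (∑<-≤-* m (λ j → f (suc j)) c (λ j → h (suc j)))

module _ {m : ℕ} where

  ∣_∣ : {U : Pred (Fin m) ℓ} → Decidable U → ℕ
  ∣ U? ∣ = ∑[ y ∈ allFin m ] 𝟙 (U? y)

  ∣∣-cong : {U : Pred (Fin m) ℓ} {V : Pred (Fin m) ℓ′} (U? : Decidable U) (V? : Decidable V) →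
            (∀ y → U y → V y) → (∀ y → V y → U y) → ∣ U? ∣ ≡ ∣ V? ∣
  ∣∣-cong U? V? f g = ∑-ext (λ y → 𝟙-cong (f y) (g y) (U? y) (V? y)) (allFin m)

  ∅? : Decidable {A = Fin m} (λ _ → ⊥)
  ∅? _ = no (λ ())

  ∣∅∣ : ∣ ∅? ∣ ≡ 0
  ∣∅∣ = ∑-zero (allFin m)

  ∣∁∣ : {U : Pred (Fin m) ℓ} (U? : Decidable U) → ∣ (λ y → ¬? (U? y)) ∣ ≡ m ∸ ∣ U? ∣
  ∣∁∣ U? = trans (sym (ℕₚ.m+n∸m≡n ∣ U? ∣ _))
                 (cong (_∸ ∣ U? ∣) (trans (∑-𝟙-¬ U? (allFin m)) (Listₚ.length-tabulate (λ i → i))))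

  ∣singleton∣ : (w : Fin m) → ∣ (Finₚ._≟ w) ∣ ≡ 1
  ∣singleton∣ w = go w
    where
    go : ∀ {m} (w : Fin m) → ∑[ y ∈ allFin m ] 𝟙 (y Finₚ.≟ w) ≡ 1
    go {suc m} Fin.zero    = cong suc (trans (∑-tabulate {m = m} _ Fin.suc) (∑-zero (allFin m)))
    go {suc m} (Fin.suc w) = trans (∑-tabulate {m = m} _ Fin.suc)
                                   (trans (∑-ext (λ y → 𝟙-cong Finₚ.suc-injective (cong Fin.suc) _ _) (allFin m)) (go w))

  ∑-singleton-* : (w : Fin m) (c : ℕ) → ∑[ y ∈ allFin m ] (𝟙 (y Finₚ.≟ w) * c) ≡ c
  ∑-singleton-* w c = trans (∑-*ʳ c _ (allFin m)) (trans (cong (_* c) (∣singleton∣ w)) (ℕₚ.+-identityʳ c))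

  insert? : {U : Pred (Fin m) ℓ} (h : Fin m) → Decidable U → Decidable (λ y → y ≡ h ⊎ U y)
  insert? h U? y = (y Finₚ.≟ h) ⊎-dec U? y

  ∣insert∣ : {U : Pred (Fin m) ℓ} (h : Fin m) (U? : Decidable U) → ¬ U h → ∣ insert? h U? ∣ ≡ suc ∣ U? ∣
  ∣insert∣ h U? h∉U =
    trans (∑-ext (λ y → 𝟙-disjoint-⊎ (λ p → p) inj₁ inj₂ (λ { refl → h∉U }) (y Finₚ.≟ h) (U? y) (insert? h U? y)) (allFin m))
          (trans (∑-+ _ _ (allFin m)) (cong (_+ ∣ U? ∣) (∣singleton∣ h)))

-- Counting permutations with a prescribed prefix

AgreeBelow : ∀ {k} {X : Set a} → ℕ → Vec X k → Vec X k → Set a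
AgreeBelow i σ ρ = ∀ p → toℕ p < i → lookup σ p ≡ lookup ρ p

agreeBelow? : ∀ {m k} (i : ℕ) (σ ρ : Vec (Fin m) k) → Dec (AgreeBelow i σ ρ)
agreeBelow? i σ ρ = Finₚ.all? (λ p → (toℕ p ℕ.<? i) →-dec (lookup σ p Finₚ.≟ lookup ρ p))

module _ {k : ℕ} {X : Set a} {i : ℕ} {x y : X} {v ρ : Vec X k} where

  agreeBelow-∷⁺ : x ≡ y → AgreeBelow i v ρ → AgreeBelow (suc i) (x ∷ v) (y ∷ ρ)
  agreeBelow-∷⁺ x≡y ag Fin.zero    _         = x≡y
  agreeBelow-∷⁺ x≡y ag (Fin.suc p) (s≤s p<i) = ag p p<i

  agreeBelow-∷⁻ : AgreeBelow (suc i) (x ∷ v) (y ∷ ρ) → x ≡ y × AgreeBelow i v ρ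
  agreeBelow-∷⁻ ag = ag Fin.zero (s≤s z≤n) , λ p p<i → ag (Fin.suc p) (s≤s p<i)

∑-allVecs-suc : ∀ {k m} (f : Vec (Fin m) (suc k) → ℕ) →
                ∑ f (allVecs (suc k) m) ≡ ∑[ x ∈ allFin m ] ∑[ v ∈ allVecs k m ] f (x ∷ v)
∑-allVecs-suc {k} {m} f = trans (∑-concatMap f (λ x → List.map (x ∷_) (allVecs k m)) (allFin m))
                                (∑-ext (λ x → ∑-map f (x ∷_) (allVecs k m)) (allFin m))

∈-allVecs : ∀ {k m} (v : Vec (Fin m) k) → v ∈ allVecs k m
∈-allVecs []                = here refl
∈-allVecs {suc k} {m} (x ∷ v) =
  ∈ₚ.∈-concat⁺′ (∈ₚ.∈-map⁺ (x ∷_) (∈-allVecs v)) (∈ₚ.∈-map⁺ (λ x → List.map (x ∷_) (allVecs k m)) (∈ₚ.∈-allFin x))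

_≟ᵥ_ : ∀ {m k} (v w : Vec (Fin m) k) → Dec (v ≡ w)
_≟ᵥ_ = Vecₚ.≡-dec Finₚ._≟_

∑-singleton-allVecs : ∀ {m} k (w : Vec (Fin m) k) → ∑[ v ∈ allVecs k m ] 𝟙 (v ≟ᵥ w) ≡ 1
∑-singleton-allVecs zero    []      = refl
∑-singleton-allVecs {m} (suc k) (y ∷ w) = begin
  ∑[ v ∈ allVecs (suc k) m ] 𝟙 (v ≟ᵥ (y ∷ w))
    ≡⟨ ∑-allVecs-suc {k} {m} _ ⟩
  ∑[ x ∈ allFin m ] ∑[ v ∈ allVecs k m ] 𝟙 ((x ∷ v) ≟ᵥ (y ∷ w))
    ≡⟨ ∑-ext (λ x → trans (∑-ext (λ v → split x v) (allVecs k m)) (∑-*ˡ (𝟙 (x Finₚ.≟ y)) _ (allVecs k m))) (allFin m) ⟩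
  ∑[ x ∈ allFin m ] (𝟙 (x Finₚ.≟ y) * ∑[ v ∈ allVecs k m ] 𝟙 (v ≟ᵥ w))
    ≡⟨ ∑-ext (λ x → cong (𝟙 (x Finₚ.≟ y) *_) (∑-singleton-allVecs k w)) (allFin m) ⟩
  ∑[ x ∈ allFin m ] (𝟙 (x Finₚ.≟ y) * 1)
    ≡⟨ ∑-singleton-* y 1 ⟩
  1 ∎
  where
  open ≡-Reasoning
  split : ∀ x v → 𝟙 ((x ∷ v) ≟ᵥ (y ∷ w)) ≡ 𝟙 (x Finₚ.≟ y) * 𝟙 (v ≟ᵥ w)
  split x v = trans (𝟙-cong (λ e → Vecₚ.∷-injectiveˡ e , Vecₚ.∷-injectiveʳ e) (λ { (refl , refl) → refl })
                            ((x ∷ v) ≟ᵥ (y ∷ w)) ((x Finₚ.≟ y) ×-dec (v ≟ᵥ w)))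
                    (𝟙-× (x Finₚ.≟ y) (v ≟ᵥ w))

falling : ℕ → ℕ → ℕ
falling a zero    = 1
falling a (suc k) = a * falling (ℕ.pred a) k

falling-! : ∀ a → falling a a ≡ a !
falling-! zero    = refl
falling-! (suc a) = cong (suc a *_) (falling-! a)

module _ {m : ℕ} where

  unique? : ∀ {k} (v : Vec (Fin m) k) → Dec (Unique v)
  unique? = allPairs? (λ x y → ¬? (x Finₚ.≟ y))

  Fresh : ∀ {k} → (Fin m → Set) → Vec (Fin m) k → Set
  Fresh U = All (λ y → ¬ U y)

  fresh? : ∀ {k} {U : Fin m → Set} → Decidable U → (v : Vec (Fin m) k) → Dec (Fresh U v)
  fresh? U? = all? (λ y → ¬? (U? y))

  UniqueFresh : ∀ {k} → (Fin m → Set) → Vec (Fin m) k → Set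
  UniqueFresh U v = Unique v × Fresh U v

  uniqueFresh? : ∀ {k} {U : Fin m → Set} → Decidable U → (v : Vec (Fin m) k) → Dec (UniqueFresh U v)
  uniqueFresh? U? v = unique? v ×-dec fresh? U? v

  uniqueFresh-∷⁺ : ∀ {k} {U : Fin m → Set} {x} {v : Vec (Fin m) k} →
                   ¬ U x → UniqueFresh (λ y → y ≡ x ⊎ U y) v → UniqueFresh U (x ∷ v)
  uniqueFresh-∷⁺ x∉U (uv , fv) =
    (All.map (λ f x≡y → f (inj₁ (sym x≡y))) fv ∷ uv) , (x∉U ∷ All.map (λ f u → f (inj₂ u)) fv)

  uniqueFresh-∷⁻ : ∀ {k} {U : Fin m → Set} {x} {v : Vec (Fin m) k} →
                   UniqueFresh U (x ∷ v) → ¬ U x × UniqueFresh (λ y → y ≡ x ⊎ U y) v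
  uniqueFresh-∷⁻ ((x∉v ∷ uv) , (x∉U ∷ fv)) =
    x∉U , uv , All.map (λ { (x≢y , y∉U) (inj₁ y≡x) → x≢y (sym y≡x) ; (x≢y , y∉U) (inj₂ u) → y∉U u })
                       (All.zip (x∉v , fv))

  count-uniqueFresh : ∀ k {U : Fin m → Set} (U? : Decidable U) →
                      ∑[ v ∈ allVecs k m ] 𝟙 (uniqueFresh? U? v) ≡ falling (m ∸ ∣ U? ∣) k
  count-uniqueFresh zero    U? = refl
  count-uniqueFresh (suc k) U? = begin
    ∑[ v ∈ allVecs (suc k) m ] 𝟙 (uniqueFresh? U? v)
      ≡⟨ ∑-allVecs-suc {k} {m} _ ⟩
    ∑[ x ∈ allFin m ] ∑[ v ∈ allVecs k m ] 𝟙 (uniqueFresh? U? (x ∷ v))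
      ≡⟨ ∑-ext (λ x → trans (∑-ext (split x) (allVecs k m)) (∑-*ˡ (𝟙 (¬? (U? x))) _ (allVecs k m))) (allFin m) ⟩
    ∑[ x ∈ allFin m ] (𝟙 (¬? (U? x)) * ∑[ v ∈ allVecs k m ] 𝟙 (uniqueFresh? (insert? x U?) v))
      ≡⟨ ∑-ext smaller (allFin m) ⟩
    ∑[ x ∈ allFin m ] (𝟙 (¬? (U? x)) * falling (m ∸ suc ∣ U? ∣) k)
      ≡⟨ ∑-*ʳ _ _ (allFin m) ⟩
    ∣ (λ x → ¬? (U? x)) ∣ * falling (m ∸ suc ∣ U? ∣) k
      ≡⟨ cong₂ _*_ (∣∁∣ U?) (cong (λ z → falling z k) (sym (ℕₚ.pred[m∸n]≡m∸[1+n] m ∣ U? ∣))) ⟩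
    falling (m ∸ ∣ U? ∣) (suc k) ∎
    where
    open ≡-Reasoning
    split : ∀ x v → 𝟙 (uniqueFresh? U? (x ∷ v)) ≡ 𝟙 (¬? (U? x)) * 𝟙 (uniqueFresh? (insert? x U?) v)
    split x v = trans (𝟙-cong uniqueFresh-∷⁻ (λ (x∉U , uf) → uniqueFresh-∷⁺ x∉U uf) _ _) (𝟙-× (¬? (U? x)) _)
    smaller : ∀ x → 𝟙 (¬? (U? x)) * ∑[ v ∈ allVecs k m ] 𝟙 (uniqueFresh? (insert? x U?) v)
                            ≡ 𝟙 (¬? (U? x)) * falling (m ∸ suc ∣ U? ∣) k
    smaller x with U? x
    ... | yes _   = refl
    ... | no x∉U = cong (1 *_) (trans (count-uniqueFresh k (insert? x U?))
                                      (cong (λ c → falling (m ∸ c) k) (∣insert∣ x U? x∉U)))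

  count-uniqueFresh-agreeBelow :
    ∀ k i (ρ : Vec (Fin m) k) {U : Fin m → Set} (U? : Decidable U) → UniqueFresh U ρ → i ≤ k →
    ∑[ v ∈ allVecs k m ] 𝟙 (uniqueFresh? U? v ×-dec agreeBelow? i v ρ) ≡ falling (m ∸ ∣ U? ∣ ∸ i) (k ∸ i)
  count-uniqueFresh-agreeBelow k zero ρ U? _ _ =
    trans (∑-ext (λ v → 𝟙-cong proj₁ (λ uf → uf , λ p ()) _ _) (allVecs k m)) (count-uniqueFresh k U?)
  count-uniqueFresh-agreeBelow (suc k) (suc i) (h ∷ ρ) {U} U? ufρ (s≤s i≤k) = begin
    ∑[ v ∈ allVecs (suc k) m ] 𝟙 (uniqueFresh? U? v ×-dec agreeBelow? (suc i) v (h ∷ ρ))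
      ≡⟨ ∑-allVecs-suc {k} {m} _ ⟩
    ∑[ x ∈ allFin m ] ∑[ v ∈ allVecs k m ] 𝟙 (uniqueFresh? U? (x ∷ v) ×-dec agreeBelow? (suc i) (x ∷ v) (h ∷ ρ))
      ≡⟨ ∑-ext (λ x → trans (∑-ext (split x) (allVecs k m)) (∑-*ˡ (𝟙 (x Finₚ.≟ h)) _ (allVecs k m))) (allFin m) ⟩
    ∑[ x ∈ allFin m ] (𝟙 (x Finₚ.≟ h) * ∑[ v ∈ allVecs k m ] 𝟙 (uniqueFresh? (insert? h U?) v ×-dec agreeBelow? i v ρ))
      ≡⟨ ∑-singleton-* h _ ⟩
    ∑[ v ∈ allVecs k m ] 𝟙 (uniqueFresh? (insert? h U?) v ×-dec agreeBelow? i v ρ)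
      ≡⟨ count-uniqueFresh-agreeBelow k i ρ (insert? h U?) ufρ′ i≤k ⟩
    falling (m ∸ ∣ insert? h U? ∣ ∸ i) (k ∸ i)
      ≡⟨ cong (λ c → falling (m ∸ c ∸ i) (k ∸ i)) (∣insert∣ h U? h∉U) ⟩
    falling (m ∸ suc ∣ U? ∣ ∸ i) (k ∸ i)
      ≡⟨ cong (λ a → falling a (k ∸ i)) shift ⟩
    falling (m ∸ ∣ U? ∣ ∸ suc i) (k ∸ i) ∎
    where
    open ≡-Reasoning
    h∉U : ¬ U h
    h∉U = proj₁ (uniqueFresh-∷⁻ ufρ)
    ufρ′ : UniqueFresh (λ y → y ≡ h ⊎ U y) ρ
    ufρ′ = proj₂ (uniqueFresh-∷⁻ ufρ)
    shift : m ∸ suc ∣ U? ∣ ∸ i ≡ m ∸ ∣ U? ∣ ∸ suc i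
    shift = trans (ℕₚ.∸-+-assoc m (suc ∣ U? ∣) i)
                  (trans (cong (m ∸_) (sym (ℕₚ.+-suc ∣ U? ∣ i))) (sym (ℕₚ.∸-+-assoc m ∣ U? ∣ (suc i))))
    split : ∀ x v → 𝟙 (uniqueFresh? U? (x ∷ v) ×-dec agreeBelow? (suc i) (x ∷ v) (h ∷ ρ))
                  ≡ 𝟙 (x Finₚ.≟ h) * 𝟙 (uniqueFresh? (insert? h U?) v ×-dec agreeBelow? i v ρ)
    split x v = trans (𝟙-cong to from _ _) (𝟙-× (x Finₚ.≟ h) _)
      where
      to : UniqueFresh U (x ∷ v) × AgreeBelow (suc i) (x ∷ v) (h ∷ ρ) →
           x ≡ h × UniqueFresh (λ y → y ≡ h ⊎ U y) v × AgreeBelow i v ρ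
      to (uf , ag) with agreeBelow-∷⁻ ag
      ... | refl , ag′ = refl , proj₂ (uniqueFresh-∷⁻ uf) , ag′
      from : x ≡ h × UniqueFresh (λ y → y ≡ h ⊎ U y) v × AgreeBelow i v ρ →
             UniqueFresh U (x ∷ v) × AgreeBelow (suc i) (x ∷ v) (h ∷ ρ)
      from (refl , uf , ag) = uniqueFresh-∷⁺ h∉U uf , agreeBelow-∷⁺ refl ag

isPerm⇔unique : ∀ {n} (σ : Word n) → (IsPerm σ → Unique σ) × (Unique σ → IsPerm σ)
isPerm⇔unique σ =
  (λ inj → subst Unique (Vecₚ.tabulate∘lookup σ) (Uniqueₚ.tabulate⁺ (λ {i} {j} → inj i j))) ,
  Uniqueₚ.lookup-injective

count-agreeBelow : ∀ {n} (ρ : Word n) → IsPerm ρ → ∀ j → j ≤ n →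
                   ∑[ σ ∈ allVecs n n ] 𝟙 (isPerm? σ ×-dec agreeBelow? j σ ρ) ≡ (n ∸ j) !
count-agreeBelow {n} ρ ρ-perm j j≤n = begin
  ∑[ σ ∈ allVecs n n ] 𝟙 (isPerm? σ ×-dec agreeBelow? j σ ρ)
    ≡⟨ ∑-ext (λ σ → 𝟙-cong (λ (p , ag) → (proj₁ (isPerm⇔unique σ) p , fresh∅ σ) , ag)
                           (λ ((u , _) , ag) → proj₂ (isPerm⇔unique σ) u , ag) _ _) (allVecs n n) ⟩
  ∑[ σ ∈ allVecs n n ] 𝟙 (uniqueFresh? (∅? {n}) σ ×-dec agreeBelow? j σ ρ)
    ≡⟨ count-uniqueFresh-agreeBelow n j ρ (∅? {n}) (proj₁ (isPerm⇔unique ρ) ρ-perm , fresh∅ ρ) j≤n ⟩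
  falling (n ∸ ∣ ∅? {n} ∣ ∸ j) (n ∸ j)
    ≡⟨ cong (λ c → falling (n ∸ c ∸ j) (n ∸ j)) (∣∅∣ {n}) ⟩
  falling (n ∸ j) (n ∸ j)
    ≡⟨ falling-! (n ∸ j) ⟩
  (n ∸ j) ! ∎
  where
  open ≡-Reasoning
  fresh∅ : (σ : Word n) → Fresh (λ _ → ⊥) σ
  fresh∅ σ = All.universal (λ _ ()) σ

-- Lexicographic order

module _ {m : ℕ} where

  -- Defs' _<lex_ for vectors of any length, so that ≺-trichotomy can recurse;
  -- on words the two coincide definitionally.
  _≺_ : ∀ {k} → Vec (Fin m) k → Vec (Fin m) k → Set
  σ ≺ π = ∃[ j ] (AgreeBelow (toℕ j) σ π × lookup σ j Fin.< lookup π j)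

  ≺-irrefl : ∀ {k} (σ : Vec (Fin m) k) → ¬ σ ≺ σ
  ≺-irrefl σ (j , _ , σj<σj) = Finₚ.<-irrefl refl σj<σj

  ≺-trans : ∀ {k} {σ π ρ : Vec (Fin m) k} → σ ≺ π → π ≺ ρ → σ ≺ ρ
  ≺-trans {σ = σ} {π} {ρ} (j₁ , h₁ , l₁) (j₂ , h₂ , l₂) with Finₚ.<-cmp j₁ j₂
  ... | tri< j₁<j₂ _ _ = j₁ , (λ i i<j → trans (h₁ i i<j) (h₂ i (ℕₚ.<-trans i<j j₁<j₂))) , subst (lookup σ j₁ Fin.<_) (h₂ j₁ j₁<j₂) l₁
  ... | tri≈ _ refl _  = j₁ , (λ i i<j → trans (h₁ i i<j) (h₂ i i<j)) , ℕₚ.<-trans l₁ l₂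
  ... | tri> _ _ j₂<j₁ = j₂ , (λ i i<j → trans (h₁ i (ℕₚ.<-trans i<j j₂<j₁)) (h₂ i i<j)) , subst (Fin._< lookup ρ j₂) (sym (h₁ j₂ j₂<j₁)) l₂

  ≺-∷ : ∀ {k} (x : Fin m) {σ π : Vec (Fin m) k} → σ ≺ π → (x ∷ σ) ≺ (x ∷ π)
  ≺-∷ x (j , σ≈π , l) = Fin.suc j , agreeBelow-∷⁺ refl σ≈π , l

  ≺-trichotomy : ∀ {k} (σ π : Vec (Fin m) k) → σ ≡ π ⊎ σ ≺ π ⊎ π ≺ σ
  ≺-trichotomy []      []      = inj₁ refl
  ≺-trichotomy (x ∷ σ) (y ∷ π) with Finₚ.<-cmp x y
  ... | tri< x<y _ _ = inj₂ (inj₁ (Fin.zero , (λ i ()) , x<y))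
  ... | tri> _ _ y<x = inj₂ (inj₂ (Fin.zero , (λ i ()) , y<x))
  ... | tri≈ _ refl _ with ≺-trichotomy σ π
  ...   | inj₁ refl      = inj₁ refl
  ...   | inj₂ (inj₁ σ≺π) = inj₂ (inj₁ (≺-∷ x σ≺π))
  ...   | inj₂ (inj₂ π≺σ) = inj₂ (inj₂ (≺-∷ x π≺σ))

  ≺-maximal-in : ∀ {k} {P : Vec (Fin m) k → Set} → Decidable P → (xs : List (Vec (Fin m) k)) → ∀ c → P c →
                 Σ[ μ ∈ Vec (Fin m) k ] (P μ × ¬ μ ≺ c × (∀ y → y ∈ xs → P y → ¬ μ ≺ y))
  ≺-maximal-in P? []       c Pc = c , Pc , ≺-irrefl c , λ y ()
  ≺-maximal-in P? (x ∷ xs) c Pc with P? x | ≺-trichotomy c x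
  ... | yes Px | inj₂ (inj₁ c≺x) =
    let (μ , Pμ , μ⊀x , max) = ≺-maximal-in P? xs x Px in
    μ , Pμ , (λ μ≺c → μ⊀x (≺-trans {σ = μ} {c} {x} μ≺c c≺x)) , λ { y (here refl) _ → μ⊀x ; y (there y∈xs) → max y y∈xs }
  ... | yes Px | inj₁ refl =
    let (μ , Pμ , μ⊀c , max) = ≺-maximal-in P? xs c Pc in
    μ , Pμ , μ⊀c , λ { y (here refl) _ → μ⊀c ; y (there y∈xs) → max y y∈xs }
  ... | yes Px | inj₂ (inj₂ x≺c) =
    let (μ , Pμ , μ⊀c , max) = ≺-maximal-in P? xs c Pc in
    μ , Pμ , μ⊀c , λ { y (here refl) _ μ≺x → μ⊀c (≺-trans {σ = μ} {x} {c} μ≺x x≺c) ; y (there y∈xs) → max y y∈xs }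
  ... | no ¬Px | _ =
    let (μ , Pμ , μ⊀c , max) = ≺-maximal-in P? xs c Pc in
    μ , Pμ , μ⊀c , λ { y (here refl) Py → ⊥-elim (¬Px Py) ; y (there y∈xs) → max y y∈xs }

  ≺-maximal : ∀ {k} {P : Vec (Fin m) k → Set} → Decidable P → ∀ c → P c →
              Σ[ μ ∈ Vec (Fin m) k ] (P μ × ∀ y → P y → ¬ μ ≺ y)
  ≺-maximal {k} P? c Pc =
    let (μ , Pμ , _ , max) = ≺-maximal-in P? (allVecs k m) c Pc in μ , Pμ , λ y → max y (∈-allVecs y)

  ≺-by-prefix : ∀ {k} {ρ σ μ : Vec (Fin m) k} p → AgreeBelow (suc (toℕ p)) ρ σ → AgreeBelow (toℕ p) σ μ →
                lookup σ p Fin.< lookup μ p → ρ ≺ μ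
  ≺-by-prefix p ρ≈σ σ≈μ σp<μp =
    p , (λ q q<p → trans (ρ≈σ q (ℕₚ.<-trans q<p (ℕₚ.n<1+n _))) (σ≈μ q q<p))
      , subst (Fin._< _) (sym (ρ≈σ p (ℕₚ.n<1+n _))) σp<μp

-- Transpositions, first differences and prefixes

≡-by-lookup : ∀ {k} {X : Set a} (σ π : Vec X k) → (∀ i → lookup σ i ≡ lookup π i) → σ ≡ π
≡-by-lookup σ π h = trans (sym (Vecₚ.tabulate∘lookup σ)) (trans (Vecₚ.tabulate-cong h) (Vecₚ.tabulate∘lookup π))

module _ {n : ℕ} (a b : Fin n) where

  swapF-a : swapF a b a ≡ b
  swapF-a with a Finₚ.≟ a
  ... | yes _  = refl
  ... | no a≢a = ⊥-elim (a≢a refl)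

  swapF-b : swapF a b b ≡ a
  swapF-b with b Finₚ.≟ a
  ... | yes refl = refl
  ... | no _ with b Finₚ.≟ b
  ...   | yes _  = refl
  ...   | no b≢b = ⊥-elim (b≢b refl)

  swapF-other : ∀ x → x ≢ a → x ≢ b → swapF a b x ≡ x
  swapF-other x x≢a x≢b with x Finₚ.≟ a
  ... | yes x≡a = ⊥-elim (x≢a x≡a)
  ... | no _ with x Finₚ.≟ b
  ...   | yes x≡b = ⊥-elim (x≢b x≡b)
  ...   | no _    = refl

  swapF-involutive : ∀ x → swapF a b (swapF a b x) ≡ x
  swapF-involutive x with x Finₚ.≟ a
  ... | yes refl = swapF-b
  ... | no x≢a with x Finₚ.≟ b
  ...   | yes refl = swapF-a
  ...   | no x≢b   = swapF-other x x≢a x≢b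

swapF-comm : ∀ {n} (a b x : Fin n) → swapF a b x ≡ swapF b a x
swapF-comm a b x with x Finₚ.≟ a | x Finₚ.≟ b
... | yes refl | yes refl = refl
... | yes _    | no _     = refl
... | no _     | yes _    = refl
... | no _     | no _     = refl

swapF-moving : ∀ {n} (a b w : Fin n) → swapF a b w ≢ w → ∀ x → swapF a b x ≡ swapF (swapF a b w) w x
swapF-moving a b w moved x with w Finₚ.≟ a
... | yes refl = swapF-comm w b x
... | no _ with w Finₚ.≟ b
...   | yes refl = refl
...   | no _     = ⊥-elim (moved refl)

firstDifference : ∀ {m k} (σ ρ : Vec (Fin m) k) → σ ≢ ρ →
                  ∃[ p ] (AgreeBelow (toℕ p) σ ρ × lookup σ p ≢ lookup ρ p)
firstDifference []      []      σ≢ρ = ⊥-elim (σ≢ρ refl)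
firstDifference (x ∷ σ) (y ∷ ρ) σ≢ρ with x Finₚ.≟ y
... | no x≢y   = Fin.zero , (λ p ()) , x≢y
... | yes refl =
  let (p , ag , d) = firstDifference σ ρ (λ σ≡ρ → σ≢ρ (cong (x ∷_) σ≡ρ)) in
  Fin.suc p , agreeBelow-∷⁺ refl ag , d

firstDifferenceBelow : ∀ {m k} j (σ ρ : Vec (Fin m) k) → ¬ AgreeBelow j σ ρ →
                       ∃[ p ] (toℕ p < j × AgreeBelow (toℕ p) σ ρ × lookup σ p ≢ lookup ρ p)
firstDifferenceBelow j σ ρ ¬ag
  with firstDifference σ ρ (λ { refl → ¬ag (λ _ _ → refl) })
... | p , ag , d with toℕ p ℕ.<? j
...   | yes p<j = p , p<j , ag , d
...   | no p≮j  = ⊥-elim (¬ag (λ q q<j → ag q (ℕₚ.<-≤-trans q<j (ℕₚ.≮⇒≥ p≮j))))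

module _ {n : ℕ} (σ : Word n) where

  InPrefix : ℕ → Fin n → Set
  InPrefix j v = ∃[ p ] (toℕ p < j × lookup σ p ≡ v)

  inPrefix? : ∀ j → Decidable (InPrefix j)
  inPrefix? j v = Finₚ.any? (λ p → (toℕ p ℕ.<? j) ×-dec (lookup σ p Finₚ.≟ v))

  ∣inPrefix∣ : IsPerm σ → ∀ j → j ≤ n → ∣ inPrefix? j ∣ ≡ j
  ∣inPrefix∣ σ-perm zero    _   = trans (∑-ext (λ v → 𝟙-no (inPrefix? 0 v) (λ { (p , () , _) })) (allFin n)) (∑-zero (allFin n))
  ∣inPrefix∣ σ-perm (suc j) j<n = begin
    ∣ inPrefix? (suc j) ∣      ≡⟨ ∣∣-cong (inPrefix? (suc j)) (insert? σj (inPrefix? j)) split merge ⟩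
    ∣ insert? σj (inPrefix? j) ∣ ≡⟨ ∣insert∣ σj (inPrefix? j) σj∉prefix ⟩
    suc ∣ inPrefix? j ∣         ≡⟨ cong suc (∣inPrefix∣ σ-perm j (ℕₚ.<⇒≤ j<n)) ⟩
    suc j                      ∎
    where
    open ≡-Reasoning
    q : Fin n
    q = fromℕ< j<n
    σj : Fin n
    σj = lookup σ q
    toℕq : toℕ q ≡ j
    toℕq = Finₚ.toℕ-fromℕ< j<n
    split : ∀ v → InPrefix (suc j) v → v ≡ σj ⊎ InPrefix j v
    split v (p , p<1+j , σp≡v) with ℕₚ.m<1+n⇒m<n∨m≡n p<1+j
    ... | inj₁ p<j = inj₂ (p , p<j , σp≡v)
    ... | inj₂ p≡j = inj₁ (trans (sym σp≡v) (cong (lookup σ) (Finₚ.toℕ-injective (trans p≡j (sym toℕq)))))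
    merge : ∀ v → v ≡ σj ⊎ InPrefix j v → InPrefix (suc j) v
    merge v (inj₁ v≡σj)             = q , subst (_< suc j) (sym toℕq) (ℕₚ.n<1+n j) , sym v≡σj
    merge v (inj₂ (p , p<j , σp≡v)) = p , ℕₚ.m<n⇒m<1+n p<j , σp≡v
    σj∉prefix : ¬ InPrefix j σj
    σj∉prefix (p , p<j , σp≡σj) = ℕₚ.<-irrefl (trans (cong toℕ (σ-perm p q σp≡σj)) toℕq) p<j

  ∣∁inPrefix∣ : IsPerm σ → ∀ j → j ≤ n → ∣ (λ v → ¬? (inPrefix? j v)) ∣ ≡ n ∸ j
  ∣∁inPrefix∣ σ-perm j j≤n = trans (∣∁∣ (inPrefix? j)) (cong (n ∸_) (∣inPrefix∣ σ-perm j j≤n))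

-- Arithmetic

!-mono : ∀ {a b} → a ≤ b → a ! ≤ b !
!-mono {b = b} a≤b = ∣⇒≤ {{b ℕₚ.!≢0}} (m≤n⇒m!∣n! a≤b)

∑-!*pred<! : ∀ R → ∑[ u < R ] ((R ∸ u) ! * (R ∸ suc u)) < suc R !
∑-!*pred<! zero    = s≤s z≤n
∑-!*pred<! (suc R) = begin-strict
  suc R ! * R + ∑[ u < R ] ((R ∸ u) ! * (R ∸ suc u)) <⟨ ℕₚ.+-monoʳ-< (suc R ! * R) (∑-!*pred<! R) ⟩
  suc R ! * R + suc R !                              ≡⟨ *-suc (suc R !) R ⟩
  suc R ! * suc R                                    ≤⟨ ℕₚ.*-monoʳ-≤ (suc R !) (ℕₚ.n≤1+n (suc R)) ⟩
  suc R ! * suc (suc R)                              ≡⟨ ℕₚ.*-comm (suc R !) (suc (suc R)) ⟩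
  suc (suc R) !                                      ∎
  where
  open ℕₚ.≤-Reasoning
  *-suc : ∀ a R → a * R + a ≡ a * suc R
  *-suc = solve-∀

tail-sum-bound : ∀ M k (N : ℕ → ℕ) → (∀ u → u < M → N (suc u) ≤ (M ∸ suc u) !) → M ! + N 0 ≤ k → N 0 ≤ M ! →
                 2 * ∑[ u < M ] (N u * (M ∸ suc u)) ≤ M * k
tail-sum-bound zero          k N _ _ _ = z≤n
tail-sum-bound (suc zero)    k N _ _ _ = ℕₚ.≤-trans (ℕₚ.≤-reflexive (cong (λ x → 2 * (x + 0)) (ℕₚ.*-zeroʳ (N 0)))) z≤n
tail-sum-bound (suc (suc R)) k N N≤! F+N0≤k N0≤F = begin
  2 * (N 0 * suc R + ∑[ u < suc R ] (N (suc u) * (suc R ∸ suc u)))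
    ≤⟨ ℕₚ.*-monoʳ-≤ 2 (ℕₚ.+-monoʳ-≤ (N 0 * suc R) (∑<-mono (suc R) (λ u u<1+R → ℕₚ.*-monoˡ-≤ (suc R ∸ suc u) (N≤! u (ℕₚ.m<n⇒m<1+n u<1+R))))) ⟩
  2 * (N 0 * suc R + W)
    ≤⟨ two-terms ⟩
  suc (suc R) * (F + N 0)
    ≤⟨ ℕₚ.*-monoʳ-≤ (suc (suc R)) F+N0≤k ⟩
  suc (suc R) * k ∎
  where
  open ℕₚ.≤-Reasoning
  F : ℕ
  F = suc (suc R) !
  W : ℕ
  W = ∑[ u < suc R ] ((suc R ∸ u) ! * (suc R ∸ suc u))
  W≤F : W ≤ F
  W≤F = ℕₚ.<⇒≤ (∑-!*pred<! (suc R))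
  two-terms : 2 * (N 0 * suc R + W) ≤ suc (suc R) * (F + N 0)
  two-terms = begin
    2 * (N 0 * suc R + W)                     ≡⟨ e₁ R (N 0) W ⟩
    suc (suc R) * N 0 + (N 0 * R + (W + W))   ≤⟨ ℕₚ.+-monoʳ-≤ (suc (suc R) * N 0) (ℕₚ.+-mono-≤ (ℕₚ.*-monoˡ-≤ R N0≤F) (ℕₚ.+-mono-≤ W≤F W≤F)) ⟩
    suc (suc R) * N 0 + (F * R + (F + F))     ≡⟨ e₂ R (N 0) F ⟩
    suc (suc R) * (F + N 0)                   ∎
    where
    e₁ : ∀ R X W → 2 * (X * suc R + W) ≡ suc (suc R) * X + (X * R + (W + W))
    e₁ = solve-∀
    e₂ : ∀ R X F → suc (suc R) * X + (F * R + (F + F)) ≡ suc (suc R) * (F + X)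
    e₂ = solve-∀

weighted-sum-bound : ∀ n t k (N : ℕ → ℕ) → t < n →
                     (∀ j → N j ≤ k) → (∀ j → j ≤ n → N j ≤ (n ∸ j) !) → (n ∸ suc t) ! + N (suc t) ≤ k →
                     2 * ∑[ j < n ] (N j * (n ∸ suc j)) ≤ (2 * t + 3) * (n ∸ 1) * k
weighted-sum-bound n t k N t<n N≤k N≤! gap with n ∸ suc t | ℕₚ.m+[n∸m]≡n t<n
... | M | refl = begin
  2 * ∑[ j < suc t + M ] f j
    ≡⟨ cong (2 *_) (∑<-+ (suc t) M f) ⟩
  2 * (∑[ j < suc t ] f j + ∑[ u < M ] f (suc t + u))
    ≡⟨ cong (λ x → 2 * (∑[ j < suc t ] f j + x)) (∑<-cong M (λ u → cong (Nₜ u *_) (shift u))) ⟩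
  2 * (∑[ j < suc t ] f j + ∑[ u < M ] (Nₜ u * (M ∸ suc u)))
    ≡⟨ ℕₚ.*-distribˡ-+ 2 (∑[ j < suc t ] f j) _ ⟩
  2 * ∑[ j < suc t ] f j + 2 * ∑[ u < M ] (Nₜ u * (M ∸ suc u))
    ≤⟨ ℕₚ.+-mono-≤ (ℕₚ.*-monoʳ-≤ 2 (∑<-≤-* (suc t) f (k * (t + M)) head-term))
                   (ℕₚ.≤-trans (tail-sum-bound M k Nₜ Nₜ≤! (subst (λ j → M ! + N j ≤ k) (sym t+0) gap) Nₜ0≤!)
                               (ℕₚ.*-monoˡ-≤ k (ℕₚ.m≤n+m M t))) ⟩
  2 * (suc t * (k * (t + M))) + (t + M) * k
    ≡⟨ collect t M k ⟩
  (2 * t + 3) * (t + M) * k ∎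
  where
  open ℕₚ.≤-Reasoning
  f : ℕ → ℕ
  f j = N j * (suc t + M ∸ suc j)
  Nₜ : ℕ → ℕ
  Nₜ u = N (suc t + u)
  shift : ∀ u → t + M ∸ suc (t + u) ≡ M ∸ suc u
  shift u = trans (cong (t + M ∸_) (sym (ℕₚ.+-suc t u))) (ℕₚ.[m+n]∸[m+o]≡n∸o t M (suc u))
  t+0 : suc t + 0 ≡ suc t
  t+0 = cong suc (ℕₚ.+-identityʳ t)
  head-term : ∀ j → f j ≤ k * (t + M)
  head-term j = ℕₚ.*-mono-≤ (N≤k j) (ℕₚ.m∸n≤m (t + M) j)
  Nₜ≤! : ∀ u → u < M → Nₜ (suc u) ≤ (M ∸ suc u) !
  Nₜ≤! u u<M = subst (λ x → Nₜ (suc u) ≤ x !) (ℕₚ.[m+n]∸[m+o]≡n∸o t M (suc u))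
                     (N≤! (suc t + suc u) (s≤s (ℕₚ.+-monoʳ-≤ t u<M)))
  Nₜ0≤! : Nₜ 0 ≤ M !
  Nₜ0≤! = subst (λ j → N j ≤ M !) (sym t+0)
                (subst (λ x → N (suc t) ≤ x !) (ℕₚ.m+n∸m≡n t M) (N≤! (suc t) (s≤s (ℕₚ.m≤m+n t M))))
  collect : ∀ t M k → 2 * (suc t * (k * (t + M))) + (t + M) * k ≡ (2 * t + 3) * (t + M) * k
  collect = solve-∀

-- Initial segments of the lexicographic order

module _ {n : ℕ} (A : Subset n) where

  InA : Word n → Set
  InA σ = IsPerm σ × A σ ≡ true

  inA? : (σ : Word n) → Dec (InA σ)
  inA? σ = isPerm? σ ×-dec (A σ ≟ᵇ true)

  card-as-sum : card A ≡ ∑[ σ ∈ allVecs n n ] 𝟙 (inA? σ)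
  card-as-sum = trans (length-filter (λ σ → A σ ≟ᵇ true) (Sym n))
                      (trans (∑-filter isPerm? (λ σ → 𝟙 (A σ ≟ᵇ true)) (allVecs n n))
                             (∑-ext (λ σ → sym (𝟙-× (isPerm? σ) (A σ ≟ᵇ true))) (allVecs n n)))

  lexMaximum : 0 < card A → Σ[ μ ∈ Word n ] (InA μ × ∀ σ → InA σ → ¬ μ ≺ σ)
  lexMaximum card>0 with ∑-pos (λ σ → 𝟙 (inA? σ)) (allVecs n n) (subst (0 <_) card-as-sum card>0)
  ... | σ , 0<𝟙 = ≺-maximal inA? σ (𝟙-pos (inA? σ) 0<𝟙)

module BelowLexMaximum {n : ℕ} (A : Subset n) (A-initial : IsInitialSegment A)
                       (μ : Word n) (μ∈A : InA A μ) (μ-maximal : ∀ σ → InA A σ → ¬ μ ≺ σ) where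

  below-μ-∈A : ∀ π → IsPerm π → π ≺ μ → A π ≡ true
  below-μ-∈A π π-perm π≺μ = A-initial μ π (proj₁ μ∈A) π-perm (proj₂ μ∈A) π≺μ

  true≢false : true ≢ false
  true≢false ()

  firstDifference-μ : ∀ {σ} j → InA A σ → ¬ AgreeBelow j σ μ →
                      ∃[ p ] (toℕ p < j × AgreeBelow (toℕ p) σ μ × lookup σ p Fin.< lookup μ p)
  firstDifference-μ {σ} j σ∈A σ≉μ with firstDifferenceBelow j σ μ σ≉μ
  ... | p , p<j , σ≈μ , σp≢μp with Finₚ.<-cmp (lookup σ p) (lookup μ p)
  ... | tri< σp<μp _ _ = p , p<j , σ≈μ , σp<μp
  ... | tri≈ _ σp≡μp _ = ⊥-elim (σp≢μp σp≡μp)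
  ... | tri> _ _ μp<σp = ⊥-elim (μ-maximal σ σ∈A (p , (λ q q<p → sym (σ≈μ q q<p)) , μp<σp))

  agreeBelow-μ : ∀ {σ π} i → InA A σ → IsPerm π → A π ≡ false → AgreeBelow i σ π → AgreeBelow i σ μ
  agreeBelow-μ {σ} {π} i σ∈A π-perm π∉A σ≈π with agreeBelow? i σ μ
  ... | yes σ≈μ = σ≈μ
  ... | no σ≉μ with firstDifference-μ i σ∈A σ≉μ
  ...   | p , p<i , σ≈μ , σp<μp = ⊥-elim (true≢false (trans (sym (below-μ-∈A π π-perm π≺μ)) π∉A))
    where
    π≺μ : π ≺ μ
    π≺μ = ≺-by-prefix {ρ = π} {σ} {μ} p (λ q q≤p → sym (σ≈π q (ℕₚ.<-≤-trans q≤p p<i))) σ≈μ σp<μp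

  Exit : Word n → Word n → Set
  Exit σ π = (IsPerm π × A π ≡ false) × Adj σ π

  exit? : ∀ σ π → Dec (Exit σ π)
  exit? σ π = (isPerm? π ×-dec (A π ≟ᵇ false)) ×-dec adj? σ π

  ExitAt : Word n → Fin n → Fin n → Word n → Set
  ExitAt σ i v π = Exit σ π × (AgreeBelow (toℕ i) σ π × lookup σ i ≢ lookup π i × lookup π i ≡ v)

  exitAt? : ∀ σ i v π → Dec (ExitAt σ i v π)
  exitAt? σ i v π = exit? σ π ×-dec (agreeBelow? (toℕ i) σ π ×-dec (¬? (lookup σ i Finₚ.≟ lookup π i) ×-dec (lookup π i Finₚ.≟ v)))

  Branch : Word n → Fin n → Fin n → Set
  Branch σ i v = AgreeBelow (toℕ i) σ μ × ¬ InPrefix σ (suc (toℕ i)) v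

  branch? : ∀ σ i v → Dec (Branch σ i v)
  branch? σ i v = agreeBelow? (toℕ i) σ μ ×-dec ¬? (inPrefix? σ (suc (toℕ i)) v)

  transpose : Word n → Fin n → Fin n → Word n
  transpose σ i v = Vec.map (swapF (lookup σ i) v) σ

  -- The transposition moves position i, so it exchanges the values σ(i) and π(i);
  -- injectivity of π keeps π(i) out of σ(0), …, σ(i − 1).
  exitAt⇒branch : ∀ {σ i v π} → InA A σ → ExitAt σ i v π → Branch σ i v × π ≡ transpose σ i v
  exitAt⇒branch {σ} {i} {v} {π} σ∈A (((π-perm , π∉A) , (a , b , _ , σ≡abπ)) , σ≈π , σi≢πi , refl) =
    (agreeBelow-μ (toℕ i) σ∈A π-perm π∉A σ≈π , fresh) , ≡-by-lookup π (transpose σ i v) π≡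
    where
    fresh : ¬ InPrefix σ (suc (toℕ i)) (lookup π i)
    fresh (p , p<1+i , σp≡πi) with ℕₚ.m<1+n⇒m<n∨m≡n p<1+i
    ... | inj₁ p<i = ℕₚ.<-irrefl (cong toℕ (π-perm p i (trans (sym (σ≈π p p<i)) σp≡πi))) p<i
    ... | inj₂ p≡i = σi≢πi (subst (λ q → lookup σ q ≡ lookup π i) (Finₚ.toℕ-injective p≡i) σp≡πi)
    π≡ : ∀ x → lookup π x ≡ lookup (transpose σ i v) x
    π≡ x = begin
      lookup π x                                   ≡⟨ swapF-involutive a b (lookup π x) ⟨
      swapF a b (swapF a b (lookup π x))           ≡⟨ cong (swapF a b) (σ≡abπ x) ⟨
      swapF a b (lookup σ x)                       ≡⟨ swapF-moving a b (lookup π i) (λ e → σi≢πi (trans (σ≡abπ i) e)) (lookup σ x) ⟩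
      swapF (swapF a b (lookup π i)) (lookup π i) (lookup σ x)
                                                   ≡⟨ cong (λ c → swapF c (lookup π i) (lookup σ x)) (σ≡abπ i) ⟨
      swapF (lookup σ i) (lookup π i) (lookup σ x) ≡⟨ Vecₚ.lookup-map x _ σ ⟨
      lookup (transpose σ i v) x                   ∎
      where open ≡-Reasoning

  exitsAt≤branch : ∀ {σ} → InA A σ → ∀ i v → ∑[ π ∈ allVecs n n ] 𝟙 (exitAt? σ i v π) ≤ 𝟙 (branch? σ i v)
  exitsAt≤branch {σ} σ∈A i v = begin
    ∑[ π ∈ allVecs n n ] 𝟙 (exitAt? σ i v π)
      ≤⟨ ∑-mono (λ π → 𝟙-mono (exitAt⇒branch σ∈A) (exitAt? σ i v π) (branch? σ i v ×-dec (π ≟ᵥ transpose σ i v))) (allVecs n n) ⟩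
    ∑[ π ∈ allVecs n n ] 𝟙 (branch? σ i v ×-dec (π ≟ᵥ transpose σ i v))
      ≡⟨ ∑-ext (λ π → 𝟙-× (branch? σ i v) (π ≟ᵥ transpose σ i v)) (allVecs n n) ⟩
    ∑[ π ∈ allVecs n n ] (𝟙 (branch? σ i v) * 𝟙 (π ≟ᵥ transpose σ i v))
      ≡⟨ ∑-*ˡ (𝟙 (branch? σ i v)) _ (allVecs n n) ⟩
    𝟙 (branch? σ i v) * ∑[ π ∈ allVecs n n ] 𝟙 (π ≟ᵥ transpose σ i v)
      ≡⟨ cong (𝟙 (branch? σ i v) *_) (∑-singleton-allVecs n (transpose σ i v)) ⟩
    𝟙 (branch? σ i v) * 1
      ≡⟨ ℕₚ.*-identityʳ _ ⟩
    𝟙 (branch? σ i v) ∎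
    where
    open ℕₚ.≤-Reasoning

  crossing? : ∀ σ π → Dec (A σ ≡ true × A π ≡ false)
  crossing? σ π = (A σ ≟ᵇ true) ×-dec (A π ≟ᵇ false)

  -- Shaped like the inner summand of boundarySize A, see boundary-as-sum.
  exits : Word n → ℕ
  exits σ = ∑[ π ∈ allVecs n n ] (𝟙 (isPerm? π) * (𝟙 (crossing? σ π) * 𝟙 (adj? σ π)))

  branching : Word n → ℕ
  branching σ = ∑[ i ∈ allFin n ] (𝟙 (agreeBelow? (toℕ i) σ μ) * (n ∸ suc (toℕ i)))

  exit⇒exitAt : ∀ {σ π} → A σ ≡ true → Exit σ π → 1 ≤ ∑[ i ∈ allFin n ] ∑[ v ∈ allFin n ] 𝟙 (exitAt? σ i v π)
  exit⇒exitAt {σ} {π} σ∈A exit@((_ , π∉A) , _)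
    with firstDifference σ π (λ { refl → true≢false (trans (sym σ∈A) π∉A) })
  ... | p , σ≈π , σp≢πp = begin
    1                                                      ≡⟨ 𝟙-yes (exitAt? σ p (lookup π p) π) (exit , σ≈π , σp≢πp , refl) ⟨
    𝟙 (exitAt? σ p (lookup π p) π)                         ≤⟨ ∑-∈ (λ v → 𝟙 (exitAt? σ p v π)) (∈ₚ.∈-allFin (lookup π p)) ⟩
    ∑[ v ∈ allFin n ] 𝟙 (exitAt? σ p v π)                  ≤⟨ ∑-∈ (λ i → ∑[ v ∈ allFin n ] 𝟙 (exitAt? σ i v π)) (∈ₚ.∈-allFin p) ⟩
    ∑[ i ∈ allFin n ] ∑[ v ∈ allFin n ] 𝟙 (exitAt? σ i v π) ∎
    where open ℕₚ.≤-Reasoning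

  exits≤branching : ∀ {σ} → InA A σ → exits σ ≤ branching σ
  exits≤branching {σ} σ∈A@(σ-perm , Aσ) = begin
    exits σ
      ≤⟨ ∑-mono exit-witness (allVecs n n) ⟩
    ∑[ π ∈ allVecs n n ] ∑[ i ∈ allFin n ] ∑[ v ∈ allFin n ] 𝟙 (exitAt? σ i v π)
      ≡⟨ ∑-comm _ (allVecs n n) (allFin n) ⟩
    ∑[ i ∈ allFin n ] ∑[ π ∈ allVecs n n ] ∑[ v ∈ allFin n ] 𝟙 (exitAt? σ i v π)
      ≡⟨ ∑-ext (λ i → ∑-comm _ (allVecs n n) (allFin n)) (allFin n) ⟩
    ∑[ i ∈ allFin n ] ∑[ v ∈ allFin n ] ∑[ π ∈ allVecs n n ] 𝟙 (exitAt? σ i v π)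
      ≤⟨ ∑-mono (λ i → ∑-mono (exitsAt≤branch σ∈A i) (allFin n)) (allFin n) ⟩
    ∑[ i ∈ allFin n ] ∑[ v ∈ allFin n ] 𝟙 (branch? σ i v)
      ≡⟨ ∑-ext fresh-values (allFin n) ⟩
    branching σ ∎
    where
    open ℕₚ.≤-Reasoning
    exit-witness : ∀ π → 𝟙 (isPerm? π) * (𝟙 (crossing? σ π) * 𝟙 (adj? σ π))
                       ≤ ∑[ i ∈ allFin n ] ∑[ v ∈ allFin n ] 𝟙 (exitAt? σ i v π)
    exit-witness π = subst (_≤ ∑[ i ∈ allFin n ] ∑[ v ∈ allFin n ] 𝟙 (exitAt? σ i v π)) (trans (𝟙-× (isPerm? π) _) (cong (𝟙 (isPerm? π) *_) (𝟙-× (crossing? σ π) (adj? σ π))))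
      (𝟙-≤ (isPerm? π ×-dec (crossing? σ π ×-dec adj? σ π))
           (λ (π-perm , (_ , π∉A) , σ~π) → exit⇒exitAt Aσ ((π-perm , π∉A) , σ~π)))
    fresh-values : ∀ i → ∑[ v ∈ allFin n ] 𝟙 (branch? σ i v) ≡ 𝟙 (agreeBelow? (toℕ i) σ μ) * (n ∸ suc (toℕ i))
    fresh-values i = begin-equality
      ∑[ v ∈ allFin n ] 𝟙 (branch? σ i v)
        ≡⟨ ∑-ext (λ v → 𝟙-× (agreeBelow? (toℕ i) σ μ) _) (allFin n) ⟩
      ∑[ v ∈ allFin n ] (𝟙 (agreeBelow? (toℕ i) σ μ) * 𝟙 (¬? (inPrefix? σ (suc (toℕ i)) v)))
        ≡⟨ ∑-*ˡ (𝟙 (agreeBelow? (toℕ i) σ μ)) _ (allFin n) ⟩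
      𝟙 (agreeBelow? (toℕ i) σ μ) * ∣ (λ v → ¬? (inPrefix? σ (suc (toℕ i)) v)) ∣
        ≡⟨ cong (𝟙 (agreeBelow? (toℕ i) σ μ) *_) (∣∁inPrefix∣ σ σ-perm (suc (toℕ i)) (Finₚ.toℕ<n i)) ⟩
      𝟙 (agreeBelow? (toℕ i) σ μ) * (n ∸ suc (toℕ i)) ∎

  sharing : ℕ → ℕ
  sharing j = ∑[ σ ∈ allVecs n n ] 𝟙 (inA? A σ ×-dec agreeBelow? j σ μ)

  notSharing : ℕ → ℕ
  notSharing j = ∑[ σ ∈ allVecs n n ] 𝟙 (inA? A σ ×-dec ¬? (agreeBelow? j σ μ))

  card-split : ∀ j → card A ≡ sharing j + notSharing j
  card-split j = trans (card-as-sum A) (trans (∑-ext split (allVecs n n)) (∑-+ _ _ (allVecs n n)))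
    where
    split : ∀ σ → 𝟙 (inA? A σ) ≡ 𝟙 (inA? A σ ×-dec agreeBelow? j σ μ) + 𝟙 (inA? A σ ×-dec ¬? (agreeBelow? j σ μ))
    split σ = 𝟙-disjoint-⊎ (λ σ∈A → case σ∈A (agreeBelow? j σ μ)) proj₁ proj₁ (λ (_ , ag) (_ , ¬ag) → ¬ag ag)
                             (inA? A σ ×-dec agreeBelow? j σ μ) (inA? A σ ×-dec ¬? (agreeBelow? j σ μ)) (inA? A σ)
      where
      case : InA A σ → Dec (AgreeBelow j σ μ) → _
      case σ∈A (yes ag)  = inj₁ (σ∈A , ag)
      case σ∈A (no ¬ag) = inj₂ (σ∈A , ¬ag)

  sharing≤card : ∀ j → sharing j ≤ card A
  sharing≤card j = subst (sharing j ≤_) (sym (card-split j)) (ℕₚ.m≤m+n (sharing j) (notSharing j))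

  sharing≤! : ∀ j → j ≤ n → sharing j ≤ (n ∸ j) !
  sharing≤! j j≤n = ℕₚ.≤-trans (∑-mono (λ σ → 𝟙-mono (λ ((σ-perm , _) , ag) → σ-perm , ag) _ _) (allVecs n n))
                               (ℕₚ.≤-reflexive (count-agreeBelow μ (proj₁ μ∈A) j j≤n))

  -- Every permutation sharing σ's first p + 1 entries lies below μ, hence in A, and differs from μ at p.
  !≤notSharing : ∀ {σ} j → InA A σ → ¬ AgreeBelow j σ μ → (n ∸ j) ! ≤ notSharing j
  !≤notSharing {σ} j σ∈A σ≉μ = begin
    (n ∸ j) !                                                              ≤⟨ !-mono (ℕₚ.∸-monoʳ-≤ n p<j) ⟩
    (n ∸ suc (toℕ p)) !                                                    ≡⟨ count-agreeBelow σ (proj₁ σ∈A) (suc (toℕ p)) (Finₚ.toℕ<n p) ⟨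
    ∑[ ρ ∈ allVecs n n ] 𝟙 (isPerm? ρ ×-dec agreeBelow? (suc (toℕ p)) ρ σ) ≤⟨ ∑-mono (λ ρ → 𝟙-mono below _ _) (allVecs n n) ⟩
    notSharing j                                                           ∎
    where
    open ℕₚ.≤-Reasoning
    difference : ∃[ p ] (toℕ p < j × AgreeBelow (toℕ p) σ μ × lookup σ p Fin.< lookup μ p)
    difference = firstDifference-μ j σ∈A σ≉μ
    p : Fin n
    p = proj₁ difference
    p<j : toℕ p < j
    p<j = proj₁ (proj₂ difference)
    below : ∀ {ρ} → IsPerm ρ × AgreeBelow (suc (toℕ p)) ρ σ → InA A ρ × ¬ AgreeBelow j ρ μ
    below {ρ} (ρ-perm , ρ≈σ) =
      (ρ-perm , below-μ-∈A ρ ρ-perm (≺-by-prefix {ρ = ρ} {σ} {μ} p ρ≈σ σ≈μ σp<μp)) ,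
      λ ρ≈μ → Finₚ.<-irrefl (trans (sym (ρ≈σ p (ℕₚ.n<1+n _))) (ρ≈μ p p<j)) σp<μp
      where
      σ≈μ : AgreeBelow (toℕ p) σ μ
      σ≈μ = proj₁ (proj₂ (proj₂ difference))
      σp<μp : lookup σ p Fin.< lookup μ p
      σp<μp = proj₂ (proj₂ (proj₂ difference))

  !+sharing≤card : ∀ j → j ≤ n → (n ∸ j) ! < card A → (n ∸ j) ! + sharing j ≤ card A
  !+sharing≤card j j≤n !<card with ∑-pos _ (allVecs n n) notSharing>0
    where
    notSharing>0 : 0 < notSharing j
    notSharing>0 with notSharing j in eq
    ... | suc _ = s≤s z≤n
    ... | zero  = ⊥-elim (ℕₚ.<⇒≱ !<card (begin
      card A               ≡⟨ card-split j ⟩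
      sharing j + notSharing j ≡⟨ cong (sharing j +_) eq ⟩
      sharing j + 0        ≡⟨ ℕₚ.+-identityʳ _ ⟩
      sharing j            ≤⟨ sharing≤! j j≤n ⟩
      (n ∸ j) !            ∎))
      where open ℕₚ.≤-Reasoning
  ... | σ , 0<𝟙 with 𝟙-pos (inA? A σ ×-dec ¬? (agreeBelow? j σ μ)) 0<𝟙
  ... | σ∈A , σ≉μ = begin
    (n ∸ j) ! + sharing j      ≤⟨ ℕₚ.+-monoˡ-≤ (sharing j) (!≤notSharing j σ∈A σ≉μ) ⟩
    notSharing j + sharing j   ≡⟨ ℕₚ.+-comm (notSharing j) (sharing j) ⟩
    sharing j + notSharing j   ≡⟨ card-split j ⟨
    card A                     ∎
    where open ℕₚ.≤-Reasoning

  boundary-as-sum : boundarySize A ≡ ∑[ σ ∈ allVecs n n ] (𝟙 (isPerm? σ) * exits σ)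
  boundary-as-sum = begin
    boundarySize A
      ≡⟨ length-filter (λ (σ , π) → adj? σ π) (crossPairs A) ⟩
    ∑[ (σ , π) ∈ crossPairs A ] 𝟙 (adj? σ π)
      ≡⟨ ∑-filter (λ (σ , π) → crossing? σ π) (λ (σ , π) → 𝟙 (adj? σ π)) (cartesianProduct (Sym n) (Sym n)) ⟩
    ∑[ (σ , π) ∈ cartesianProduct (Sym n) (Sym n) ] (𝟙 (crossing? σ π) * 𝟙 (adj? σ π))
      ≡⟨ ∑-cartesianProduct _ (Sym n) (Sym n) ⟩
    ∑[ σ ∈ Sym n ] ∑[ π ∈ Sym n ] (𝟙 (crossing? σ π) * 𝟙 (adj? σ π))
      ≡⟨ ∑-filter isPerm? _ (allVecs n n) ⟩
    ∑[ σ ∈ allVecs n n ] (𝟙 (isPerm? σ) * ∑[ π ∈ Sym n ] (𝟙 (crossing? σ π) * 𝟙 (adj? σ π)))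
      ≡⟨ ∑-ext (λ σ → cong (𝟙 (isPerm? σ) *_) (∑-filter isPerm? _ (allVecs n n))) (allVecs n n) ⟩
    ∑[ σ ∈ allVecs n n ] (𝟙 (isPerm? σ) * exits σ) ∎
    where open ≡-Reasoning

  boundary≤ : boundarySize A ≤ ∑[ j < n ] (sharing j * (n ∸ suc j))
  boundary≤ = begin
    boundarySize A
      ≡⟨ boundary-as-sum ⟩
    ∑[ σ ∈ allVecs n n ] (𝟙 (isPerm? σ) * exits σ)
      ≤⟨ ∑-mono (λ σ → 𝟙*-≤ (isPerm? σ) (λ σ-perm → exits≤ σ σ-perm (A σ ≟ᵇ true))) (allVecs n n) ⟩
    ∑[ σ ∈ allVecs n n ] ∑[ i ∈ allFin n ] (𝟙 (inA? A σ ×-dec agreeBelow? (toℕ i) σ μ) * w i)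
      ≡⟨ ∑-comm _ (allVecs n n) (allFin n) ⟩
    ∑[ i ∈ allFin n ] ∑[ σ ∈ allVecs n n ] (𝟙 (inA? A σ ×-dec agreeBelow? (toℕ i) σ μ) * w i)
      ≡⟨ ∑-ext (λ i → ∑-*ʳ (w i) _ (allVecs n n)) (allFin n) ⟩
    ∑[ i ∈ allFin n ] (sharing (toℕ i) * (n ∸ suc (toℕ i)))
      ≡⟨ ∑-allFin-toℕ n (λ j → sharing j * (n ∸ suc j)) ⟩
    ∑[ j < n ] (sharing j * (n ∸ suc j)) ∎
    where
    open ℕₚ.≤-Reasoning
    w : Fin n → ℕ
    w i = n ∸ suc (toℕ i)
    bound : Word n → ℕ
    bound σ = ∑[ i ∈ allFin n ] (𝟙 (inA? A σ ×-dec agreeBelow? (toℕ i) σ μ) * w i)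
    exits≤ : ∀ σ → IsPerm σ → Dec (A σ ≡ true) → exits σ ≤ bound σ
    exits≤ σ σ-perm (yes σ∈A) = ℕₚ.≤-trans (exits≤branching (σ-perm , σ∈A))
      (ℕₚ.≤-reflexive (∑-ext (λ i → cong (_* w i) (𝟙-cong ((σ-perm , σ∈A) ,_) proj₂ (agreeBelow? (toℕ i) σ μ) (inA? A σ ×-dec agreeBelow? (toℕ i) σ μ))) (allFin n)))
    exits≤ σ σ-perm (no σ∉A) =
      ℕₚ.≤-trans (ℕₚ.≤-reflexive (trans (∑-ext no-crossing (allVecs n n)) (∑-zero (allVecs n n)))) z≤n
      where
      no-crossing : ∀ π → 𝟙 (isPerm? π) * (𝟙 (crossing? σ π) * 𝟙 (adj? σ π)) ≡ 0
      no-crossing π = trans (cong (λ c → 𝟙 (isPerm? π) * (c * 𝟙 (adj? σ π))) (𝟙-no (crossing? σ π) (λ (σ∈A , _) → σ∉A σ∈A)))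
                            (ℕₚ.*-zeroʳ (𝟙 (isPerm? π)))

mainTheorem7 : (n t : ℕ) → t < n → (A : Subset n) →
    IsInitialSegment A →
    ((n ∸ t ∸ 1) !) < card A → card A ≤ (n ∸ t) ! →
    2 * boundarySize A ≤ (2 * t + 3) * (n ∸ 1) * card A
mainTheorem7 n t t<n A A-initial lower _ = begin
  2 * boundarySize A                                  ≤⟨ ℕₚ.*-monoʳ-≤ 2 boundary≤ ⟩
  2 * ∑[ j < n ] (sharing j * (n ∸ suc j))            ≤⟨ weighted-sum-bound n t (card A) sharing t<n
                                                           sharing≤card sharing≤! (!+sharing≤card (suc t) t<n lower′) ⟩
  (2 * t + 3) * (n ∸ 1) * card A                      ∎
  where
  open ℕₚ.≤-Reasoning
  lower′ : (n ∸ suc t) ! < card A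
  lower′ = subst (λ m → m ! < card A) (trans (ℕₚ.∸-+-assoc n t 1) (cong (n ∸_) (ℕₚ.+-comm t 1))) lower
  maximum : Σ[ μ ∈ Word n ] (InA A μ × ∀ σ → InA A σ → ¬ μ ≺ σ)
  maximum = lexMaximum A (ℕₚ.≤-<-trans z≤n lower)
  open BelowLexMaximum A A-initial (proj₁ maximum) (proj₁ (proj₂ maximum)) (proj₂ (proj₂ maximum))
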